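{- Let $T$ be a binary tree with $m$ nodes and root $\tau$, whose nodes are numbered $0,1,\ldots,m-1$ in inorder and identified with these numbers. Then for every $0\le u<m$, $$\sum_{j<u}(l_j+r_j)=2u-L_\tau-l_u+\mathrm{Ldepth}(u)-\mathrm{Rdepth}(u)+1.$$
   Context: The left spine of a node $u$ is the set of nodes on the downward path starting at $u$ (inclusive) that repeatedly follows left children as long as possible; the right spine is defined analogously. The left inner spine of $u$ is the right spine of the left child of $u$ (empty if there is no left child); the right inner spine of $u$ is the left spine of the right child of $u$ (empty if there is no right child). $L_v$ is the number of nodes in the left spine of $v$, and $l_v$, $r_v$ are the numbers of nodes in the left and right inner spines of $v$. $\mathrm{Ldepth}(u)$ is the number of nodes $w$ on the path from the root to $u$ whose left child also lies on that path (i.e. the number of left turns on the root-to-$u$ path); $\mathrm{Rdepth}(u)$ is defined analogously with right children. -}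

module Defs where

open import Data.Nat using (ℕ; zero; suc; _+_)

data Tree : Set where
  leaf : Tree
  node : Tree → Tree → Tree

size : Tree → ℕ
size leaf       = 0
size (node l r) = suc (size l + size r)

leftChild : Tree → Tree
leftChild leaf       = leaf
leftChild (node l _) = l

rightChild : Tree → Tree
rightChild leaf       = leaf
rightChild (node _ r) = r

leftSpine : Tree → ℕ
leftSpine leaf       = 0
leftSpine (node l _) = suc (leftSpine l)

rightSpine : Tree → ℕ
rightSpine leaf       = 0
rightSpine (node _ r) = suc (rightSpine r)

-- l_v : size of the left inner spine (right spine of the left child)
innerL : Tree → ℕ
innerL t = rightSpine (leftChild t)

-- r_v : size of the right inner spine (left spine of the right child)
innerR : Tree → ℕ
innerR t = leftSpine (rightChild t)

-- Nodes are numbered 0..m-1 in inorder: in 'node l r', the nodes of l get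
-- numbers 0..size l - 1, the root gets size l, the nodes of r follow.
-- subtreeAt t u = the subtree rooted at node number u (leaf if out of range).
data Where : Set where
  inLeft  : Where
  atRoot  : Where
  inRight : ℕ → Where        -- u ≡ s + 1 + k : node k of the right subtree

locate : ℕ → ℕ → Where
locate zero    zero    = atRoot
locate zero    (suc s) = inLeft
locate (suc u) zero    = inRight u
locate (suc u) (suc s) = locate u s

subtreeAt : Tree → ℕ → Tree
subtreeAt leaf u = leaf
subtreeAt (node l r) u with locate u (size l)
... | inLeft    = subtreeAt l u
... | atRoot    = node l r
... | inRight k = subtreeAt r k

Ldepth : Tree → ℕ → ℕ
Rdepth : Tree → ℕ → ℕ
Ldepth leaf u = 0
Ldepth (node l r) u with locate u (size l)
... | inLeft    = suc (Ldepth l u)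
... | atRoot    = 0
... | inRight k = Ldepth r k
Rdepth leaf u = 0
Rdepth (node l r) u with locate u (size l)
... | inLeft    = Rdepth l u
... | atRoot    = 0
... | inRight k = suc (Rdepth r k)

lAt : Tree → ℕ → ℕ
lAt t u = innerL (subtreeAt t u)

rAt : Tree → ℕ → ℕ
rAt t u = innerR (subtreeAt t u)

-- Summed over all nodes, Σ_v (l_v + r_v) = 2m − L_τ − R_τ. The identity then follows by induction on the tree: a node of the left subtree sees the same prefix, one
-- more node on the root's left spine and one more left turn; the root sees the whole left
-- subtree, whose total is the formula above; a node of the right subtree sees the whole
-- left subtree, the root's inner spines R_left + L_right, and one more right turn.
module Submission where

open import Defs
open import Data.Nat using (ℕ; _<_; _≤_; _+_; _*_; zero; suc; z≤n; s≤s; s≤s⁻¹)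
open import Data.Nat.Properties using (+-assoc; +-suc; +-identityʳ; ≤-refl; <⇒≤; <-≤-trans; +-cancelˡ-≤)
open import Data.Nat.Tactic.RingSolver using (solve-∀)
open import Data.Integer using (+_) renaming (_+_ to _+ℤ_; _-_ to _-ℤ_)
open import Data.Integer.Properties using (pos-+)
import Data.Integer.Tactic.RingSolver as ℤ-Solver
open import Data.List using (map; upTo; applyUpTo)
open import Data.List.Properties using (map-upTo)
open import Data.Nat.ListAction using (sum)
open import Function using (_∘_)
open import Relation.Binary.PropositionalEquality using (_≡_; refl; sym; cong; cong₂)
open Relation.Binary.PropositionalEquality.≡-Reasoning

sum-applyUpTo-cong : ∀ n {g h : ℕ → ℕ} → (∀ {j} → j < n → g j ≡ h j) →
  sum (applyUpTo g n) ≡ sum (applyUpTo h n)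
sum-applyUpTo-cong zero    g≗h = refl
sum-applyUpTo-cong (suc n) g≗h =
  cong₂ _+_ (g≗h (s≤s z≤n)) (sum-applyUpTo-cong n (g≗h ∘ s≤s))

sum-applyUpTo-+suc : ∀ a b (g : ℕ → ℕ) → sum (applyUpTo g (a + suc b))
  ≡ sum (applyUpTo g a) + g a + sum (applyUpTo (λ k → g (a + suc k)) b)
sum-applyUpTo-+suc zero    b g = refl
sum-applyUpTo-+suc (suc a) b g = begin
  g 0 + sum (applyUpTo (g ∘ suc) (a + suc b))
    ≡⟨ cong (_+_ (g 0)) (sum-applyUpTo-+suc a b (g ∘ suc)) ⟩
  g 0 + (x + g (suc a) + y)  ≡⟨ sym (+-assoc (g 0) _ y) ⟩
  g 0 + (x + g (suc a)) + y  ≡⟨ cong (_+ y) (sym (+-assoc (g 0) x _)) ⟩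
  g 0 + x + g (suc a) + y    ∎
  where
  x y : ℕ
  x = sum (applyUpTo (g ∘ suc) a)
  y = sum (applyUpTo (λ k → g (suc a + suc k)) b)

-- A view of 'locate u s' whose indices refine u, so that matching on it rewrites u in the goal.
data Position (s : ℕ) : ℕ → Set where
  left  : ∀ {u} → u < s → Position s u
  root  : Position s s
  right : ∀ k → Position s (s + suc k)

position : ∀ s u → Position s u
position zero    zero    = root
position zero    (suc u) = right u
position (suc s) zero    = left (s≤s z≤n)
position (suc s) (suc u) with position s u
... | left u<s = left (s≤s u<s)
... | root     = root
... | right k  = right k

locate-< : ∀ {u s} → u < s → locate u s ≡ inLeft
locate-< {zero}  {suc s} _         = refl
locate-< {suc u} {suc s} (s≤s u<s) = locate-< u<s

locate-self : ∀ s → locate s s ≡ atRoot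
locate-self zero    = refl
locate-self (suc s) = locate-self s

locate-+suc : ∀ s k → locate (s + suc k) s ≡ inRight k
locate-+suc zero    k = refl
locate-+suc (suc s) k = locate-+suc s k

subtreeAt-left : ∀ l r {j} → j < size l → subtreeAt (node l r) j ≡ subtreeAt l j
subtreeAt-left l r j<l rewrite locate-< j<l = refl

subtreeAt-right : ∀ l r k → subtreeAt (node l r) (size l + suc k) ≡ subtreeAt r k
subtreeAt-right l r k rewrite locate-+suc (size l) k = refl

subtreeAt-root : ∀ l r → subtreeAt (node l r) (size l) ≡ node l r
subtreeAt-root l r rewrite locate-self (size l) = refl

innerSpines : Tree → ℕ
innerSpines t = innerL t + innerR t

innerPrefix : Tree → ℕ → ℕ
innerPrefix t u = sum (applyUpTo (innerSpines ∘ subtreeAt t) u)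

innerPrefix-left : ∀ l r {u} → u ≤ size l → innerPrefix (node l r) u ≡ innerPrefix l u
innerPrefix-left l r {u} u≤l =
  sum-applyUpTo-cong u (λ j<u → cong innerSpines (subtreeAt-left l r (<-≤-trans j<u u≤l)))

innerPrefix-right : ∀ l r k → innerPrefix (node l r) (size l + suc k)
  ≡ innerPrefix l (size l) + (rightSpine l + leftSpine r) + innerPrefix r k
innerPrefix-right l r k = begin
  innerPrefix (node l r) (size l + suc k)
    ≡⟨ sum-applyUpTo-+suc (size l) k (innerSpines ∘ subtreeAt (node l r)) ⟩
  innerPrefix (node l r) (size l) + innerSpines (subtreeAt (node l r) (size l))
    + sum (applyUpTo (λ j → innerSpines (subtreeAt (node l r) (size l + suc j))) k)
    ≡⟨ cong₂ _+_
         (cong₂ _+_ (innerPrefix-left l r ≤-refl) (cong innerSpines (subtreeAt-root l r)))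
         (sum-applyUpTo-cong k (λ {j} _ → cong innerSpines (subtreeAt-right l r j))) ⟩
  innerPrefix l (size l) + (rightSpine l + leftSpine r) + innerPrefix r k ∎

-- Every node other than the root lies on exactly one left inner spine unless it is on the
-- right spine of the root, and on exactly one right inner spine unless it is on the left spine.
innerPrefix-total : ∀ t → innerPrefix t (size t) + leftSpine t + rightSpine t ≡ 2 * size t
innerPrefix-total leaf       = refl
innerPrefix-total (node l r) = begin
  innerPrefix (node l r) (suc (size l + size r)) + suc Ll + suc Rr
    ≡⟨ cong (λ u → innerPrefix (node l r) u + suc Ll + suc Rr) (sym (+-suc (size l) (size r))) ⟩
  innerPrefix (node l r) (size l + suc (size r)) + suc Ll + suc Rr
    ≡⟨ cong (λ x → x + suc Ll + suc Rr) (innerPrefix-right l r (size r)) ⟩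
  Pl + (Rl + Lr) + Pr + suc Ll + suc Rr
    ≡⟨ regroup Pl Pr Ll Rl Lr Rr ⟩
  (Pl + Ll + Rl) + (Pr + Lr + Rr) + 2
    ≡⟨ cong₂ (λ x y → x + y + 2) (innerPrefix-total l) (innerPrefix-total r) ⟩
  2 * size l + 2 * size r + 2
    ≡⟨ double (size l) (size r) ⟩
  2 * suc (size l + size r) ∎
  where
  Pl Pr Ll Rl Lr Rr : ℕ
  Pl = innerPrefix l (size l)
  Pr = innerPrefix r (size r)
  Ll = leftSpine l
  Rl = rightSpine l
  Lr = leftSpine r
  Rr = rightSpine r
  regroup : ∀ Pl Pr Ll Rl Lr Rr →
    Pl + (Rl + Lr) + Pr + suc Ll + suc Rr ≡ (Pl + Ll + Rl) + (Pr + Lr + Rr) + 2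
  regroup = solve-∀
  double : ∀ a b → 2 * a + 2 * b + 2 ≡ 2 * suc (a + b)
  double = solve-∀

-- The theorem over ℕ, with every subtracted term moved to the left-hand side.
innerPrefix-identity : ∀ t u → u < size t →
  innerPrefix t u + leftSpine t + lAt t u + Rdepth t u ≡ 2 * u + Ldepth t u + 1
innerPrefix-identity leaf       u ()
innerPrefix-identity (node l r) u u<m with position (size l) u
... | left u<l rewrite innerPrefix-left l r (<⇒≤ u<l) | locate-< u<l = begin
  innerPrefix l u + suc (leftSpine l) + lAt l u + Rdepth l u
    ≡⟨ shift (innerPrefix l u) (leftSpine l) (lAt l u) (Rdepth l u) ⟩
  suc (innerPrefix l u + leftSpine l + lAt l u + Rdepth l u)
    ≡⟨ cong suc (innerPrefix-identity l u u<l) ⟩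
  suc (2 * u + Ldepth l u + 1)
    ≡⟨ cong (_+ 1) (sym (+-suc (2 * u) (Ldepth l u))) ⟩
  2 * u + suc (Ldepth l u) + 1 ∎
  where
  shift : ∀ P L x R → P + suc L + x + R ≡ suc (P + L + x + R)
  shift = solve-∀
... | root rewrite innerPrefix-left l r ≤-refl | locate-self (size l) = begin
  innerPrefix l (size l) + suc (leftSpine l) + rightSpine l + 0
    ≡⟨ shift (innerPrefix l (size l)) (leftSpine l) (rightSpine l) ⟩
  innerPrefix l (size l) + leftSpine l + rightSpine l + 1
    ≡⟨ cong (_+ 1) (innerPrefix-total l) ⟩
  2 * size l + 1
    ≡⟨ cong (_+ 1) (sym (+-identityʳ (2 * size l))) ⟩
  2 * size l + 0 + 1 ∎
  where
  shift : ∀ P L R → P + suc L + R + 0 ≡ P + L + R + 1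
  shift = solve-∀
... | right k rewrite innerPrefix-right l r k | locate-+suc (size l) k = begin
  Pl + (Rl + Lr) + innerPrefix r k + suc Ll + lAt r k + suc (Rdepth r k)
    ≡⟨ regroup Pl Ll Rl Lr (innerPrefix r k) (lAt r k) (Rdepth r k) ⟩
  (Pl + Ll + Rl) + (innerPrefix r k + Lr + lAt r k + Rdepth r k) + 2
    ≡⟨ cong₂ (λ x y → x + y + 2) (innerPrefix-total l) (innerPrefix-identity r k k<r) ⟩
  2 * size l + (2 * k + Ldepth r k + 1) + 2
    ≡⟨ double (size l) k (Ldepth r k) ⟩
  2 * (size l + suc k) + Ldepth r k + 1 ∎
  where
  Pl Ll Rl Lr : ℕ
  Pl = innerPrefix l (size l)
  Ll = leftSpine l
  Rl = rightSpine l
  Lr = leftSpine r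
  k<r : k < size r
  k<r = +-cancelˡ-≤ (size l) (suc k) (size r) (s≤s⁻¹ u<m)
  regroup : ∀ Pl Ll Rl Lr Pr x R → Pl + (Rl + Lr) + Pr + suc Ll + x + suc R
    ≡ (Pl + Ll + Rl) + (Pr + Lr + x + R) + 2
  regroup = solve-∀
  double : ∀ s k d → 2 * s + (2 * k + d + 1) + 2 ≡ 2 * (s + suc k) + d + 1
  double = solve-∀

pos-+₃ : ∀ x y z → + (x + y + z) ≡ + x +ℤ + y +ℤ + z
pos-+₃ x y z = begin
  + (x + y + z)      ≡⟨ pos-+ (x + y) z ⟩
  + (x + y) +ℤ + z   ≡⟨ cong (_+ℤ + z) (pos-+ x y) ⟩
  + x +ℤ + y +ℤ + z  ∎

isolate-ℤ : ∀ a c d f b e → a + c + d + f ≡ b + e + 1 →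
  + a ≡ + b -ℤ + c -ℤ + d +ℤ + e -ℤ + f +ℤ + 1
isolate-ℤ a c d f b e eq = begin
  + a
    ≡⟨ cancel (+ a) (+ c) (+ d) (+ f) ⟩
  + a +ℤ + c +ℤ + d +ℤ + f -ℤ + c -ℤ + d -ℤ + f
    ≡⟨ cong (λ x → x -ℤ + c -ℤ + d -ℤ + f) balance ⟩
  + b +ℤ + e +ℤ + 1 -ℤ + c -ℤ + d -ℤ + f
    ≡⟨ regroup (+ b) (+ c) (+ d) (+ e) (+ f) ⟩
  + b -ℤ + c -ℤ + d +ℤ + e -ℤ + f +ℤ + 1 ∎
  where
  balance : + a +ℤ + c +ℤ + d +ℤ + f ≡ + b +ℤ + e +ℤ + 1
  balance = begin
    + a +ℤ + c +ℤ + d +ℤ + f  ≡⟨ cong (_+ℤ + f) (pos-+₃ a c d) ⟨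
    + (a + c + d) +ℤ + f      ≡⟨ pos-+ (a + c + d) f ⟨
    + (a + c + d + f)         ≡⟨ cong +_ eq ⟩
    + (b + e + 1)             ≡⟨ pos-+₃ b e 1 ⟩
    + b +ℤ + e +ℤ + 1         ∎
  cancel : ∀ A C D F → A ≡ A +ℤ C +ℤ D +ℤ F -ℤ C -ℤ D -ℤ F
  cancel = ℤ-Solver.solve-∀
  regroup : ∀ B C D E F → B +ℤ E +ℤ + 1 -ℤ C -ℤ D -ℤ F ≡ B -ℤ C -ℤ D +ℤ E -ℤ F +ℤ + 1
  regroup = ℤ-Solver.solve-∀

lemma6 : (T : Tree) (m : ℕ) → size T ≡ m → (u : ℕ) → u < m →
    + sum (map (λ j → lAt T j + rAt T j) (upTo u))
      ≡ + (2 * u) -ℤ + leftSpine T -ℤ + lAt T u +ℤ + Ldepth T u -ℤ + Rdepth T u +ℤ + 1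
lemma6 T m refl u u<m = begin
  + sum (map (λ j → lAt T j + rAt T j) (upTo u))
    ≡⟨ cong (λ xs → + sum xs) (map-upTo (λ j → lAt T j + rAt T j) u) ⟩
  + innerPrefix T u
    ≡⟨ isolate-ℤ (innerPrefix T u) (leftSpine T) (lAt T u) (Rdepth T u) (2 * u) (Ldepth T u)
                 (innerPrefix-identity T u u<m) ⟩
  + (2 * u) -ℤ + leftSpine T -ℤ + lAt T u +ℤ + Ldepth T u -ℤ + Rdepth T u +ℤ + 1 ∎
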